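{- Let $G$ and $H$ be two non-trivial graphs of order $n$ and $n'$, respectively, such that $G\oplus H$ is connected. Then: (i) $\dim_s(G\oplus H)\le nn'-\max\{(\varpi(G)-1)\omega(H),\ \omega(G)(\varpi(H)-1)\}-1$. (ii) If there exists a twins-free clique of $G$ of cardinality $\varpi(G)$ containing no vertex of degree $n-1$ and there exists a twins-free clique of $H$ of cardinality $\varpi(H)$ containing no vertex of degree $n'-1$, then $\dim_s(G\oplus H)\le nn'-\max\{\varpi(G)\omega(H),\ \omega(G)\varpi(H)\}$. (iii) If there exists a twins-free clique of $G$ of cardinality $\varpi(G)$ containing no vertex of degree $n-1$, then $\dim_s(G\oplus H)\le nn'-\max\{\varpi(G)\omega(H),\ \omega(G)(\varpi(H)-1)+1\}$.
   Context: All graphs are finite and simple; non-trivial means at least two vertices. $\omega$ denotes the clique number. A twins-free clique is a clique $X$ such that $N_G[u]\ne N_G[v]$ for all distinct $u,v\in X$; $\varpi(G)$ is the maximum cardinality of a twins-free clique. The Cartesian sum $G\oplus H$ of $G=(V_1,E_1)$ and $H=(V_2,E_2)$ has vertex set $V_1\times V_2$, with $(a,b)(c,d)$ an edge iff $ac\in E_1$ or $bd\in E_2$. For a connected graph $G$, a vertex $w$ strongly resolves $u,v$ if $d_G(w,u)=d_G(w,v)+d_G(v,u)$ or $d_G(w,v)=d_G(w,u)+d_G(u,v)$; $\dim_s(G)$ is the minimum cardinality of a set $S$ such that every pair of vertices is strongly resolved by some vertex of $S$. -}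

module Defs where

open import Data.Nat using (ℕ; zero; suc; _+_; _*_; _≤_)
open import Data.Bool using (Bool; true; false; _∨_)
open import Data.Bool.Properties using (∨-comm)
open import Data.Fin using (Fin; remQuot; _≟_)
open import Data.Fin.Subset using (Subset; _∈_; ∣_∣)
open import Data.Vec using (tabulate)
open import Data.Sum using (_⊎_)
open import Data.Product using (Σ; _×_; _,_; proj₁; proj₂; ∃)
open import Relation.Nullary using (¬_; does)
open import Relation.Binary.PropositionalEquality using (_≡_; _≢_; cong₂; refl)

record Graph (n : ℕ) : Set where
  field
    adj    : Fin n → Fin n → Bool
    sym    : ∀ u v → adj u v ≡ adj v u
    irrefl : ∀ u → adj u u ≡ false
open Graph public

_~[_]_ : {n : ℕ} → Fin n → Graph n → Fin n → Set
u ~[ G ] v = adj G u v ≡ true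

data Walk {n : ℕ} (G : Graph n) : Fin n → Fin n → ℕ → Set where
  here : ∀ {u} → Walk G u u 0
  step : ∀ {u v w k} → u ~[ G ] v → Walk G v w k → Walk G u w (suc k)

Connected : {n : ℕ} → Graph n → Set
Connected G = ∀ u v → ∃ λ k → Walk G u v k

Dist : {n : ℕ} → Graph n → Fin n → Fin n → ℕ → Set
Dist G u v k = Walk G u v k × (∀ m → Walk G u v m → k ≤ m)

StronglyResolves : {n : ℕ} → Graph n → Fin n → Fin n → Fin n → Set
StronglyResolves G w u v =
  Σ ℕ λ a → Σ ℕ λ b → Σ ℕ λ c →
    Dist G w u a × Dist G w v b × Dist G u v c ×
    ((a ≡ b + c) ⊎ (b ≡ a + c))

StrongResolvingSet : {n : ℕ} → Graph n → Subset n → Set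
StrongResolvingSet G S = ∀ u v → Σ _ λ w → w ∈ S × StronglyResolves G w u v

IsStrongMetricDim : {n : ℕ} → Graph n → ℕ → Set
IsStrongMetricDim G d =
  (Σ _ λ S → StrongResolvingSet G S × ∣ S ∣ ≡ d) ×
  (∀ S → StrongResolvingSet G S → d ≤ ∣ S ∣)

IsClique : {n : ℕ} → Graph n → Subset n → Set
IsClique G X = ∀ u v → u ∈ X → v ∈ X → u ≢ v → u ~[ G ] v

IsCliqueNumber : {n : ℕ} → Graph n → ℕ → Set
IsCliqueNumber G k =
  (Σ _ λ X → IsClique G X × ∣ X ∣ ≡ k) ×
  (∀ X → IsClique G X → ∣ X ∣ ≤ k)

N[_]_ : {n : ℕ} → Graph n → Fin n → Subset n
N[ G ] u = tabulate λ w → does (u ≟ w) ∨ adj G u w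

IsTwinsFreeClique : {n : ℕ} → Graph n → Subset n → Set
IsTwinsFreeClique G X =
  IsClique G X × (∀ u v → u ∈ X → v ∈ X → u ≢ v → N[ G ] u ≢ N[ G ] v)

IsTwinsFreeCliqueNumber : {n : ℕ} → Graph n → ℕ → Set
IsTwinsFreeCliqueNumber G k =
  (Σ _ λ X → IsTwinsFreeClique G X × ∣ X ∣ ≡ k) ×
  (∀ X → IsTwinsFreeClique G X → ∣ X ∣ ≤ k)

deg : {n : ℕ} → Graph n → Fin n → ℕ
deg G v = ∣ tabulate (adj G v) ∣

-- Cartesian sum G ⊕ H on Fin (n * n') ≅ Fin n × Fin n' (via remQuot / combine)
pairAdj : {n n' : ℕ} → Graph n → Graph n' → Fin n × Fin n' → Fin n × Fin n' → Bool
pairAdj G H (a , b) (c , d) = adj G a c ∨ adj H b d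

⊕adj : {n n' : ℕ} → Graph n → Graph n' → Fin (n * n') → Fin (n * n') → Bool
⊕adj {n} {n'} G H x y = pairAdj G H (remQuot n' x) (remQuot n' y)

pairSym : {n n' : ℕ} (G : Graph n) (H : Graph n') → ∀ p q → pairAdj G H p q ≡ pairAdj G H q p
pairSym G H (a , b) (c , d) = cong₂ _∨_ (sym G a c) (sym H b d)

pairIrrefl : {n n' : ℕ} (G : Graph n) (H : Graph n') → ∀ p → pairAdj G H p p ≡ false
pairIrrefl G H (a , b) rewrite irrefl G a | irrefl H b = refl

_⊕_ : {n n' : ℕ} → Graph n → Graph n' → Graph (n * n')
_⊕_ {n} {n'} G H = record
  { adj = ⊕adj G H
  ; sym = λ x y → pairSym G H (remQuot n' x) (remQuot n' y)
  ; irrefl = λ x → pairIrrefl G H (remQuot n' x) }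

-- If P is a twins-free clique of a connected graph K with at least two vertices, the complement
-- of P is a strong resolving set: two members u, v of P are adjacent and, not being twins, one of
-- them, say u, has a neighbour w outside N[v]; then w ∉ P and d(w,v) = 2 = d(w,u) + d(u,v).
-- Hence dim_s(K) + |P| ≤ |V(K)|, and it remains to find large twins-free cliques in G ⊕ H.
-- For a twins-free clique X of G and a clique W of H, X × W is one when no member of X is
-- universal: two vertices in the same row a are told apart by a non-neighbour of a. A twins-free
-- clique has at most one universal vertex x₀, and (X ∖ {x₀}) × W ∪ {(x₀, b)} always works.
-- These sets and their mirror images give the three bounds.

module Submission where

open import Defs hiding (sym)
open import Data.Bool using (Bool; true; false; _∧_; _∨_)
import Data.Bool as Bool
open import Data.Bool.Properties using (∨-comm; ∨-zeroʳ; ∧-conicalˡ; ∧-conicalʳ)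
open import Data.Empty using (⊥-elim)
open import Data.Fin using (Fin; zero; suc; toℕ; fromℕ<; remQuot; quotient; remainder; combine; _≟_)
open import Data.Fin.Properties
  using (any?; ¬∀⟶∃¬; toℕ<n; toℕ-fromℕ<; remQuot-combine; combine-remQuot)
open import Data.Fin.Subset
  using (Subset; inside; outside; _∈_; _∉_; _⊆_; ⊥; ⁅_⁆; ∁; _∪_; _-_; ∣_∣; Nonempty)
open import Data.Fin.Subset.Properties
  using (_∈?_; nonempty?; x∉p⇒x∈∁p; x∈∁p⇒x∉p; x∈p∪q⁺; x∈p∪q⁻; p⊆p∪q; x∈⁅x⁆; x∈⁅y⁆⇒x≡y;
         x≢y⇒x∉⁅y⁆; x∉⁅y⁆⇒x≢y; ⊆-antisym; p─q⊆p; p─⊥≡p; ∣⊥∣≡0; ∣⁅x⁆∣≡1; ∣p∣≤n; ∣∁p∣≡n∸∣p∣;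
         p⊂q⇒∣p∣<∣q∣)
open import Data.Nat using (ℕ; zero; suc; _+_; _*_; _∸_; _≤_; _<_; _⊔_; z≤n; s≤s)
open import Data.Nat.Induction using (<-rec)
open import Data.Nat.Properties
  using (≤-reflexive; ≤-trans; ≮⇒≥; m≤n⇒m≤1+n; m≤o∸n⇒m+n≤o; +-comm; +-assoc; +-identityʳ;
         +-monoˡ-≤; +-monoʳ-≤; *-mono-≤; *-monoˡ-≤; *-monoʳ-≤; ∸-monoˡ-≤; ⊔-lub;
         +-distribˡ-⊔; +-distribʳ-⊔; module ≤-Reasoning)
open import Data.Product using (Σ; ∃; _×_; _,_; proj₁; proj₂; swap; uncurry)
open import Data.Sum using (_⊎_; inj₁; inj₂)
import Data.Sum as Sum
open import Data.Vec using ([]; _∷_; _++_; lookup; tabulate; there)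
open import Data.Vec.Properties
  using (lookup-++ˡ; lookup-++ʳ; lookup-replicate; lookup∘tabulate; tabulate-cong;
         []=⇒lookup; lookup⇒[]=)
open import Function using (_∘_)
open import Relation.Nullary using (¬_; Dec; yes; no; does; contradiction)
open import Relation.Nullary.Decidable using (_×-dec_; ¬?; dec-false; decidable-stable)
open import Relation.Unary using (Decidable)
open import Relation.Binary.PropositionalEquality
  using (_≡_; _≢_; refl; sym; trans; cong; cong₂; subst; module ≡-Reasoning)

least : {P : ℕ → Set} → Decidable P → ∀ {k} → P k → ∃ λ m → P m × (∀ j → P j → m ≤ j)
least {P} P? {k} = <-rec Least search k
  where
  Least : ℕ → Set
  Least k = P k → ∃ λ m → P m × (∀ j → P j → m ≤ j)
  search : ∀ k → (∀ {j} → j < k → Least j) → Least k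
  search k below Pk with any? (λ (j : Fin k) → P? (toℕ j))
  ... | yes (j , Pj) = below (toℕ<n j) Pj
  ... | no none = k , Pk , λ j Pj → ≮⇒≥ λ j<k →
        none (fromℕ< j<k , subst P (sym (toℕ-fromℕ< j<k)) Pj)

two-vertices : ∀ {N} → 2 ≤ N → Σ (Fin N) λ u → Σ (Fin N) λ v → u ≢ v
two-vertices {suc (suc _)} _ = zero , suc zero , λ ()
two-vertices {suc zero} (s≤s ())

∈-tabulate⁺ : ∀ {n} {f : Fin n → Bool} {x} → f x ≡ true → x ∈ tabulate f
∈-tabulate⁺ {f = f} {x} fx = lookup⇒[]= x _ (trans (lookup∘tabulate f x) fx)

∈-tabulate⁻ : ∀ {n} {f : Fin n → Bool} {x} → x ∈ tabulate f → f x ≡ true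
∈-tabulate⁻ {f = f} {x} x∈ = trans (sym (lookup∘tabulate f x)) ([]=⇒lookup x∈)

∣p++q∣≡∣p∣+∣q∣ : ∀ {m n} (p : Subset m) (q : Subset n) → ∣ p ++ q ∣ ≡ ∣ p ∣ + ∣ q ∣
∣p++q∣≡∣p∣+∣q∣ []            q = refl
∣p++q∣≡∣p∣+∣q∣ (outside ∷ p) q = ∣p++q∣≡∣p∣+∣q∣ p q
∣p++q∣≡∣p∣+∣q∣ (inside  ∷ p) q = cong suc (∣p++q∣≡∣p∣+∣q∣ p q)

infixr 7 _⊗_

_⊗_ : ∀ {m n} → Subset m → Subset n → Subset (m * n)
[]            ⊗ q = []
(outside ∷ p) ⊗ q = ⊥ ++ p ⊗ q
(inside  ∷ p) ⊗ q = q ++ p ⊗ q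

∣p⊗q∣≡∣p∣*∣q∣ : ∀ {m n} (p : Subset m) (q : Subset n) → ∣ p ⊗ q ∣ ≡ ∣ p ∣ * ∣ q ∣
∣p⊗q∣≡∣p∣*∣q∣ []            q = refl
∣p⊗q∣≡∣p∣*∣q∣ {n = n} (outside ∷ p) q =
  trans (∣p++q∣≡∣p∣+∣q∣ (⊥ {n = n}) (p ⊗ q)) (cong₂ _+_ (∣⊥∣≡0 n) (∣p⊗q∣≡∣p∣*∣q∣ p q))
∣p⊗q∣≡∣p∣*∣q∣ (inside  ∷ p) q =
  trans (∣p++q∣≡∣p∣+∣q∣ q (p ⊗ q)) (cong (∣ q ∣ +_) (∣p⊗q∣≡∣p∣*∣q∣ p q))

lookup-⊗ : ∀ {m n} (p : Subset m) (q : Subset n) i j →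
           lookup (p ⊗ q) (combine i j) ≡ lookup p i ∧ lookup q j
lookup-⊗ {n = n} (outside ∷ p) q zero    j =
  trans (lookup-++ˡ (⊥ {n = n}) (p ⊗ q) j) (lookup-replicate j outside)
lookup-⊗          (inside  ∷ p) q zero    j = lookup-++ˡ q (p ⊗ q) j
lookup-⊗ {n = n} (outside ∷ p) q (suc i) j =
  trans (lookup-++ʳ (⊥ {n = n}) (p ⊗ q) (combine i j)) (lookup-⊗ p q i j)
lookup-⊗          (inside  ∷ p) q (suc i) j =
  trans (lookup-++ʳ q (p ⊗ q) (combine i j)) (lookup-⊗ p q i j)

∈-⊗⁻ : ∀ {m n} (p : Subset m) (q : Subset n) {z} → z ∈ p ⊗ q →
       quotient n z ∈ p × remainder {m} n z ∈ q
∈-⊗⁻ {m} {n} p q {z} z∈p⊗q =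
  lookup⇒[]= _ p (∧-conicalˡ _ _ in-both) , lookup⇒[]= _ q (∧-conicalʳ _ _ in-both)
  where
  in-both : lookup p (quotient n z) ∧ lookup q (remainder {m} n z) ≡ true
  in-both = trans (sym (lookup-⊗ p q _ _))
                  (trans (cong (lookup (p ⊗ q)) (combine-remQuot {m} n z)) ([]=⇒lookup z∈p⊗q))

remQuot-injective : ∀ {m} n {u v : Fin (m * n)} → remQuot n u ≡ remQuot n v → u ≡ v
remQuot-injective {m} n {u} {v} eq =
  trans (sym (combine-remQuot {m} n u))
        (trans (cong (uncurry (combine {m} {n})) eq) (combine-remQuot {m} n v))

x∉p-x : ∀ {n} (p : Subset n) x → x ∉ p - x
x∉p-x (s ∷ p) zero    ()
x∉p-x (s ∷ p) (suc x) (there x∈p-x) = x∉p-x p x x∈p-x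

x∈p-y⁻ : ∀ {n} {p : Subset n} {x y} → x ∈ p - y → x ∈ p × x ≢ y
x∈p-y⁻ {p = p} {y = y} x∈p-y = p─q⊆p p ⁅ y ⁆ x∈p-y , λ { refl → x∉p-x p y x∈p-y }

∣p∣≤1+∣p-x∣ : ∀ {n} (p : Subset n) x → ∣ p ∣ ≤ suc ∣ p - x ∣
∣p∣≤1+∣p-x∣ (outside ∷ p) zero    = m≤n⇒m≤1+n (≤-reflexive (cong ∣_∣ (sym (p─⊥≡p p))))
∣p∣≤1+∣p-x∣ (inside  ∷ p) zero    = s≤s (≤-reflexive (cong ∣_∣ (sym (p─⊥≡p p))))
∣p∣≤1+∣p-x∣ (outside ∷ p) (suc x) = ∣p∣≤1+∣p-x∣ p x
∣p∣≤1+∣p-x∣ (inside  ∷ p) (suc x) = s≤s (∣p∣≤1+∣p-x∣ p x)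

x∉p⇒∣p∣<∣p∪⁅x⁆∣ : ∀ {n} {p : Subset n} {x} → x ∉ p → ∣ p ∣ < ∣ p ∪ ⁅ x ⁆ ∣
x∉p⇒∣p∣<∣p∪⁅x⁆∣ {x = x} x∉p = p⊂q⇒∣p∣<∣q∣ (p⊆p∪q ⁅ x ⁆ , x , x∈p∪q⁺ (inj₂ (x∈⁅x⁆ x)) , x∉p)

InProduct : ∀ {m n} → Subset m → Subset n → Fin m × Fin n → Set
InProduct X W (a , b) = a ∈ X × b ∈ W

-- X ⊗ W with row x₀ cut down to the single vertex (x₀ , b₀). Two members in a common row a are
-- separated only through a non-neighbour of a in G, so here x₀ may be universal.
rowPinned : ∀ {m n} → Subset m → Fin m → Subset n → Fin n → Subset (m * n)
rowPinned X x₀ W b₀ = (X - x₀) ⊗ W ∪ ⁅ combine x₀ b₀ ⁆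

columnPinned : ∀ {m n} → Subset m → Fin m → Subset n → Fin n → Subset (m * n)
columnPinned W a₀ Y y₀ = W ⊗ (Y - y₀) ∪ ⁅ combine a₀ y₀ ⁆

∣rowPinned∣ : ∀ {m n} (X : Subset m) x₀ (W : Subset n) b₀ →
              (∣ X ∣ ∸ 1) * ∣ W ∣ + 1 ≤ ∣ rowPinned X x₀ W b₀ ∣
∣rowPinned∣ X x₀ W b₀ = begin
  (∣ X ∣ ∸ 1) * ∣ W ∣ + 1 ≤⟨ +-monoˡ-≤ 1 (*-monoˡ-≤ ∣ W ∣ (∸-monoˡ-≤ 1 (∣p∣≤1+∣p-x∣ X x₀))) ⟩
  ∣ X - x₀ ∣ * ∣ W ∣ + 1  ≡⟨ cong (_+ 1) (∣p⊗q∣≡∣p∣*∣q∣ (X - x₀) W) ⟨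
  ∣ (X - x₀) ⊗ W ∣ + 1    ≡⟨ +-comm _ 1 ⟩
  suc ∣ (X - x₀) ⊗ W ∣    ≤⟨ x∉p⇒∣p∣<∣p∪⁅x⁆∣ corner∉ ⟩
  ∣ rowPinned X x₀ W b₀ ∣ ∎
  where
  open ≤-Reasoning
  corner∉ : combine x₀ b₀ ∉ (X - x₀) ⊗ W
  corner∉ corner∈ = x∉p-x X x₀
    (subst (_∈ X - x₀) (cong proj₁ (remQuot-combine x₀ b₀)) (proj₁ (∈-⊗⁻ (X - x₀) W corner∈)))

∣columnPinned∣ : ∀ {m n} (W : Subset m) a₀ (Y : Subset n) y₀ →
                 ∣ W ∣ * (∣ Y ∣ ∸ 1) + 1 ≤ ∣ columnPinned W a₀ Y y₀ ∣
∣columnPinned∣ W a₀ Y y₀ = begin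
  ∣ W ∣ * (∣ Y ∣ ∸ 1) + 1    ≤⟨ +-monoˡ-≤ 1 (*-monoʳ-≤ ∣ W ∣ (∸-monoˡ-≤ 1 (∣p∣≤1+∣p-x∣ Y y₀))) ⟩
  ∣ W ∣ * ∣ Y - y₀ ∣ + 1     ≡⟨ cong (_+ 1) (∣p⊗q∣≡∣p∣*∣q∣ W (Y - y₀)) ⟨
  ∣ W ⊗ (Y - y₀) ∣ + 1       ≡⟨ +-comm _ 1 ⟩
  suc ∣ W ⊗ (Y - y₀) ∣       ≤⟨ x∉p⇒∣p∣<∣p∪⁅x⁆∣ corner∉ ⟩
  ∣ columnPinned W a₀ Y y₀ ∣ ∎
  where
  open ≤-Reasoning
  corner∉ : combine a₀ y₀ ∉ W ⊗ (Y - y₀)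
  corner∉ corner∈ = x∉p-x Y y₀
    (subst (_∈ Y - y₀) (cong proj₂ (remQuot-combine a₀ y₀)) (proj₂ (∈-⊗⁻ W (Y - y₀) corner∈)))

∈-rowPinned⁻ : ∀ {m n} {X : Subset m} {x₀ W b₀ z} → z ∈ rowPinned X x₀ W b₀ →
               InProduct (X - x₀) W (remQuot n z) ⊎ remQuot n z ≡ (x₀ , b₀)
∈-rowPinned⁻ {n = n} {X} {x₀} {W} {b₀} z∈ with x∈p∪q⁻ ((X - x₀) ⊗ W) _ z∈
... | inj₁ z∈⊗ = inj₁ (∈-⊗⁻ (X - x₀) W z∈⊗)
... | inj₂ z∈⁅c⁆ = inj₂ (trans (cong (remQuot n) (x∈⁅y⁆⇒x≡y _ z∈⁅c⁆)) (remQuot-combine x₀ b₀))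

∈-columnPinned⁻ : ∀ {m n} {W : Subset m} {a₀ Y y₀ z} → z ∈ columnPinned W a₀ Y y₀ →
                  InProduct (Y - y₀) W (swap (remQuot n z)) ⊎ swap (remQuot n z) ≡ (y₀ , a₀)
∈-columnPinned⁻ {n = n} {W} {a₀} {Y} {y₀} z∈ with x∈p∪q⁻ (W ⊗ (Y - y₀)) _ z∈
... | inj₁ z∈⊗ = inj₁ (swap (∈-⊗⁻ W (Y - y₀) z∈⊗))
... | inj₂ z∈⁅c⁆ =
  inj₂ (cong swap (trans (cong (remQuot n) (x∈⁅y⁆⇒x≡y _ z∈⁅c⁆)) (remQuot-combine a₀ y₀)))

-- The relation is arbitrary so
-- that separation can be established on pairs, the vertices of G ⊕ H before their encoding by combine.
module _ {V : Set} (_∼_ : V → V → Bool) where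

  PrivateNeighbour : V → V → Set
  PrivateNeighbour u v = Σ V λ w → w ≢ v × u ∼ w ≡ true × v ∼ w ≡ false

  Separated : V → V → Set
  Separated u v = u ∼ v ≡ true × (PrivateNeighbour u v ⊎ PrivateNeighbour v u)

separated-pullback : {V V′ : Set} {_∼_ : V → V → Bool} {_∼′_ : V′ → V′ → Bool}
  (g : V′ → V) (f : V → V′) → (∀ w → g (f w) ≡ w) → (∀ x y → x ∼′ y ≡ g x ∼ g y) →
  ∀ {x y} → Separated _∼_ (g x) (g y) → Separated _∼′_ x y
separated-pullback {_∼_ = _∼_} {_∼′_} g f gf≡id ∼′≡∼ {x} {y} (x∼y , private-neighbour) =
  trans (∼′≡∼ x y) x∼y , Sum.map pull pull private-neighbour
  where
  pull : ∀ {u v} → PrivateNeighbour _∼_ (g u) (g v) → PrivateNeighbour _∼′_ u v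
  pull {u} {v} (w , w≢gv , gu∼w , gv≁w) =
    f w , (λ fw≡v → w≢gv (trans (sym (gf≡id w)) (cong g fw≡v))) ,
    trans (∼′≡∼ u (f w)) (trans (cong (g u ∼_) (gf≡id w)) gu∼w) ,
    trans (∼′≡∼ v (f w)) (trans (cong (g v ∼_) (gf≡id w)) gv≁w)

-- Twins-free cliques and strong resolving sets

module _ {N : ℕ} (K : Graph N) where

  ~-sym : ∀ {u v} → u ~[ K ] v → v ~[ K ] u
  ~-sym {u} {v} u∼v = trans (Graph.sym K v u) u∼v

  ≁-sym : ∀ {u v} → adj K u v ≡ false → adj K v u ≡ false
  ≁-sym {u} {v} u≁v = trans (Graph.sym K v u) u≁v

  ~⇒≢ : ∀ {u v} → u ~[ K ] v → u ≢ v
  ~⇒≢ {u} u∼u refl with trans (sym u∼u) (irrefl K u)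
  ... | ()

  lookup-N[] : ∀ u w → lookup (N[ K ] u) w ≡ does (u ≟ w) ∨ adj K u w
  lookup-N[] u = lookup∘tabulate _

  privateNeighbour⇒N[]≢ : ∀ {u v} → PrivateNeighbour (adj K) u v → N[ K ] u ≢ N[ K ] v
  privateNeighbour⇒N[]≢ {u} {v} (w , w≢v , u∼w , v≁w) N[u]≡N[v] =
    contradiction (trans (sym w∈N[u]) (trans (cong (λ X → lookup X w) N[u]≡N[v]) w∉N[v])) λ ()
    where
    w∈N[u] : lookup (N[ K ] u) w ≡ true
    w∈N[u] = trans (lookup-N[] u w) (trans (cong (_ ∨_) u∼w) (∨-zeroʳ _))
    w∉N[v] : lookup (N[ K ] v) w ≡ false
    w∉N[v] = trans (lookup-N[] v w) (cong₂ _∨_ (dec-false (v ≟ w) (w≢v ∘ sym)) v≁w)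

  N[]≢⇒separated : ∀ {u v} → u ~[ K ] v → N[ K ] u ≢ N[ K ] v → Separated (adj K) u v
  N[]≢⇒separated {u} {v} u∼v N[u]≢N[v] = u∼v , uncurry private-at
    (¬∀⟶∃¬ N (λ w → closed u w ≡ closed v w) (λ w → closed u w Bool.≟ closed v w)
           (N[u]≢N[v] ∘ tabulate-cong))
    where
    closed : Fin N → Fin N → Bool
    closed x w = does (x ≟ w) ∨ adj K x w
    private-at : ∀ i → closed u i ≢ closed v i →
                 PrivateNeighbour (adj K) u v ⊎ PrivateNeighbour (adj K) v u
    private-at i ne with u ≟ i | v ≟ i
    ... | yes refl | _ = contradiction (sym (trans (cong (_ ∨_) (~-sym u∼v)) (∨-zeroʳ _))) ne
    ... | no _ | yes refl = contradiction u∼v ne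
    ... | no u≢i | no v≢i with adj K u i in u∼i | adj K v i in v∼i
    ... | true  | false = inj₁ (i , v≢i ∘ sym , u∼i , v∼i)
    ... | false | true  = inj₂ (i , u≢i ∘ sym , v∼i , u∼i)
    ... | true  | true  = contradiction refl ne
    ... | false | false = contradiction refl ne

  twinsFreeClique⇒separated : ∀ {P u v} → IsTwinsFreeClique K P → u ∈ P → v ∈ P → u ≢ v →
                              Separated (adj K) u v
  twinsFreeClique⇒separated (clique , twinsFree) u∈P v∈P u≢v =
    N[]≢⇒separated (clique _ _ u∈P v∈P u≢v) (twinsFree _ _ u∈P v∈P u≢v)

  separated⇒twinsFreeClique : ∀ {P} → (∀ {u v} → u ∈ P → v ∈ P → u ≢ v → Separated (adj K) u v) →
                              IsTwinsFreeClique K P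
  separated⇒twinsFreeClique separated =
    (λ _ _ u∈P v∈P u≢v → proj₁ (separated u∈P v∈P u≢v)) ,
    λ _ _ u∈P v∈P u≢v → N[]≢ (separated u∈P v∈P u≢v)
    where
    N[]≢ : ∀ {u v} → Separated (adj K) u v → N[ K ] u ≢ N[ K ] v
    N[]≢ (_ , inj₁ pn) = privateNeighbour⇒N[]≢ pn
    N[]≢ (_ , inj₂ pn) = privateNeighbour⇒N[]≢ pn ∘ sym

  walk? : ∀ m u v → Dec (Walk K u v m)
  walk? zero u v with u ≟ v
  ... | yes refl = yes here
  ... | no u≢v = no λ { here → u≢v refl }
  walk? (suc m) u v with any? (λ x → (adj K u x Bool.≟ true) ×-dec walk? m x v)
  ... | yes (x , u∼x , walk) = yes (step u∼x walk)
  ... | no none = no λ { (step {v = x} u∼x walk) → none (x , u∼x , walk) }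

  distance : Connected K → ∀ u v → ∃ (Dist K u v)
  distance connected u v = least (λ m → walk? m u v) (proj₂ (connected u v))

  reverse : ∀ {u v k} → Walk K u v k → Walk K v u k
  reverse here = here
  reverse (step u∼x walk) = append (reverse walk) (~-sym u∼x)
    where
    append : ∀ {u v w k} → Walk K u v k → v ~[ K ] w → Walk K u w (suc k)
    append here v∼w = step v∼w here
    append (step u∼x walk) v∼w = step u∼x (append walk v∼w)

  dist-sym : ∀ {u v k} → Dist K u v k → Dist K v u k
  dist-sym (walk , shortest) = reverse walk , λ m walk′ → shortest m (reverse walk′)

  dist-refl : ∀ {u} → Dist K u u 0
  dist-refl = here , λ _ _ → z≤n

  dist-adjacent : ∀ {u v} → u ~[ K ] v → Dist K u v 1
  dist-adjacent u∼v = step u∼v here , shortest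
    where
    shortest : ∀ m → Walk K _ _ m → 1 ≤ m
    shortest zero here = ⊥-elim (~⇒≢ u∼v refl)
    shortest (suc m) _ = s≤s z≤n

  dist-two : ∀ {u x v} → u ~[ K ] x → x ~[ K ] v → adj K u v ≡ false → u ≢ v → Dist K u v 2
  dist-two u∼x x∼v u≁v u≢v = step u∼x (step x∼v here) , shortest
    where
    shortest : ∀ m → Walk K _ _ m → 2 ≤ m
    shortest zero here = ⊥-elim (u≢v refl)
    shortest (suc zero) (step u∼v here) = contradiction (trans (sym u∼v) u≁v) λ ()
    shortest (suc (suc m)) _ = s≤s (s≤s z≤n)

  resolves-sym : ∀ {w u v} → StronglyResolves K w v u → StronglyResolves K w u v
  resolves-sym (a , b , c , wv , wu , vu , geodesic) =
    b , a , c , wu , wv , dist-sym vu , Sum.swap geodesic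

  endpoint-resolves : ∀ {u v k} → Dist K u v k → StronglyResolves K u u v
  endpoint-resolves {k = k} uv = 0 , k , k , dist-refl , uv , uv , inj₂ refl

  resolves-diagonal : ∀ {w u a} → Dist K w u a → StronglyResolves K w u u
  resolves-diagonal {a = a} wu = a , a , 0 , wu , wu , dist-refl , inj₁ (sym (+-identityʳ a))

  privateNeighbour-resolves : ∀ {u v} → u ~[ K ] v → (pn : PrivateNeighbour (adj K) u v) →
                              StronglyResolves K (proj₁ pn) u v
  privateNeighbour-resolves u∼v (w , w≢v , u∼w , v≁w) =
    1 , 2 , 1 , dist-adjacent (~-sym u∼w) , dist-two (~-sym u∼w) u∼v (≁-sym v≁w) w≢v ,
    dist-adjacent u∼v , inj₂ refl

  privateNeighbour∈∁ : ∀ {P u v} → IsClique K P → v ∈ P → (pn : PrivateNeighbour (adj K) u v) →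
                       proj₁ pn ∈ ∁ P
  privateNeighbour∈∁ clique v∈P (w , w≢v , _ , v≁w) =
    x∉p⇒x∈∁p λ w∈P → contradiction (trans (sym (clique _ _ v∈P w∈P (w≢v ∘ sym))) v≁w) λ ()

  ∁-nonempty : ∀ {P u v} → u ≢ v → IsTwinsFreeClique K P → Nonempty (∁ P)
  ∁-nonempty {P} {u} {v} u≢v tfc with u ∈? P | v ∈? P
  ... | no u∉P | _      = u , x∉p⇒x∈∁p u∉P
  ... | yes _  | no v∉P = v , x∉p⇒x∈∁p v∉P
  ... | yes u∈P | yes v∈P with proj₂ (twinsFreeClique⇒separated tfc u∈P v∈P u≢v)
  ... | inj₁ pn = proj₁ pn , privateNeighbour∈∁ (proj₁ tfc) v∈P pn
  ... | inj₂ pn = proj₁ pn , privateNeighbour∈∁ (proj₁ tfc) u∈P pn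

  ∁-strongResolving : ∀ {P} → Connected K → IsTwinsFreeClique K P → Nonempty (∁ P) →
                      StrongResolvingSet K (∁ P)
  ∁-strongResolving {P} connected tfc (o , o∈∁P) u v with u ∈? P | v ∈? P
  ... | no u∉P | _      = u , x∉p⇒x∈∁p u∉P , endpoint-resolves (proj₂ (distance connected u v))
  ... | yes _  | no v∉P = v , x∉p⇒x∈∁p v∉P ,
                          resolves-sym (endpoint-resolves (proj₂ (distance connected v u)))
  ... | yes u∈P | yes v∈P with u ≟ v
  ... | yes refl = o , o∈∁P , resolves-diagonal (proj₂ (distance connected o u))
  ... | no u≢v with twinsFreeClique⇒separated tfc u∈P v∈P u≢v
  ... | u∼v , inj₁ pn = proj₁ pn , privateNeighbour∈∁ (proj₁ tfc) v∈P pn ,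
                        privateNeighbour-resolves u∼v pn
  ... | u∼v , inj₂ pn = proj₁ pn , privateNeighbour∈∁ (proj₁ tfc) u∈P pn ,
                        resolves-sym (privateNeighbour-resolves (~-sym u∼v) pn)

  strongMetricDim+twinsFreeClique≤order : ∀ {d P} → 2 ≤ N → Connected K → IsStrongMetricDim K d →
                                          IsTwinsFreeClique K P → d + ∣ P ∣ ≤ N
  strongMetricDim+twinsFreeClique≤order {d} {P} 2≤N connected (_ , minimal) tfc =
    m≤o∸n⇒m+n≤o d (∣p∣≤n P) (subst (d ≤_) (∣∁p∣≡n∸∣p∣ P) (minimal (∁ P) ∁P-resolving))
    where
    ∁P-resolving =
      ∁-strongResolving connected tfc (∁-nonempty (proj₂ (proj₂ (two-vertices 2≤N))) tfc)

  NonUniversal : Fin N → Set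
  NonUniversal a = ∃ λ x → x ≢ a × adj K a x ≡ false

  nonUniversal? : ∀ a → Dec (NonUniversal a)
  nonUniversal? a = any? λ x → ¬? (x ≟ a) ×-dec (adj K a x Bool.≟ false)

  universal⇒deg≡N∸1 : ∀ {a} → ¬ NonUniversal a → deg K a ≡ N ∸ 1
  universal⇒deg≡N∸1 {a} universal = begin
    ∣ tabulate (adj K a) ∣ ≡⟨ cong ∣_∣ neighbours≡∁⁅a⁆ ⟩
    ∣ ∁ ⁅ a ⁆ ∣            ≡⟨ ∣∁p∣≡n∸∣p∣ ⁅ a ⁆ ⟩
    N ∸ ∣ ⁅ a ⁆ ∣          ≡⟨ cong (N ∸_) (∣⁅x⁆∣≡1 a) ⟩
    N ∸ 1                  ∎
    where
    open ≡-Reasoning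
    adjacent : ∀ x → x ≢ a → a ~[ K ] x
    adjacent x x≢a with adj K a x in a∼x
    ... | true  = refl
    ... | false = ⊥-elim (universal (x , x≢a , a∼x))
    neighbours≡∁⁅a⁆ : tabulate (adj K a) ≡ ∁ ⁅ a ⁆
    neighbours≡∁⁅a⁆ = ⊆-antisym
      (λ {x} x∈ → x∉p⇒x∈∁p (x≢y⇒x∉⁅y⁆ (~⇒≢ (∈-tabulate⁻ x∈) ∘ sym)))
      (λ {x} x∈ → ∈-tabulate⁺ (adjacent x (x∉⁅y⁆⇒x≢y (x∈∁p⇒x∉p x∈))))

  deg≢N∸1⇒nonUniversal : ∀ {a} → deg K a ≢ N ∸ 1 → NonUniversal a
  deg≢N∸1⇒nonUniversal {a} deg≢ with nonUniversal? a
  ... | yes nonUniversal = nonUniversal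
  ... | no universal     = ⊥-elim (deg≢ (universal⇒deg≡N∸1 universal))

  universal-unique : ∀ {X a c} → IsTwinsFreeClique K X → a ∈ X → c ∈ X →
                     ¬ NonUniversal a → ¬ NonUniversal c → a ≡ c
  universal-unique tfc a∈X c∈X ¬nuA ¬nuC with _ ≟ _
  ... | yes a≡c = a≡c
  ... | no a≢c with proj₂ (twinsFreeClique⇒separated tfc a∈X c∈X a≢c)
  ... | inj₁ (w , w≢c , _ , c≁w) = ⊥-elim (¬nuC (w , w≢c , c≁w))
  ... | inj₂ (w , w≢a , _ , a≁w) = ⊥-elim (¬nuA (w , w≢a , a≁w))

  -- x₀ is the universal member of X if there is one, otherwise any member; default is only
  -- returned when X is empty.
  universal-candidate : ∀ {X} → IsTwinsFreeClique K X → Fin N →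
                        ∃ λ x₀ → ∀ {a} → a ∈ X → a ≢ x₀ → x₀ ∈ X × NonUniversal a
  universal-candidate {X} tfc default with any? (λ a → a ∈? X ×-dec ¬? (nonUniversal? a))
  ... | yes (x₀ , x₀∈X , x₀-universal) = x₀ , λ a∈X a≢x₀ → x₀∈X ,
        decidable-stable (nonUniversal? _)
          (λ a-universal → a≢x₀ (universal-unique tfc a∈X x₀∈X a-universal x₀-universal))
  ... | no none with nonempty? X
  ... | yes (x₀ , x₀∈X) = x₀ , λ a∈X _ → x₀∈X ,
        decidable-stable (nonUniversal? _) (λ a-universal → none (_ , a∈X , a-universal))
  ... | no empty = default , λ a∈X _ → ⊥-elim (empty (_ , a∈X))

  twinsFreeClique-⊆ : ∀ {X Y} → Y ⊆ X → IsTwinsFreeClique K X → IsTwinsFreeClique K Y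
  twinsFreeClique-⊆ Y⊆X (clique , twinsFree) =
    (λ u v u∈Y v∈Y → clique u v (Y⊆X u∈Y) (Y⊆X v∈Y)) ,
    (λ u v u∈Y v∈Y → twinsFree u v (Y⊆X u∈Y) (Y⊆X v∈Y))

-- Twins-free cliques of the Cartesian sum

module _ {n n'} (G : Graph n) (H : Graph n') where

  separated-acrossRows : ∀ {X a c} → IsTwinsFreeClique G X → a ∈ X → c ∈ X → a ≢ c → ∀ b d →
                         Separated (pairAdj G H) (a , b) (c , d)
  separated-acrossRows tfc a∈X c∈X a≢c b d with twinsFreeClique⇒separated G tfc a∈X c∈X a≢c
  ... | a∼c , private-neighbour =
    cong (_∨ adj H b d) a∼c , Sum.map (lift b d) (lift d b) private-neighbour
    where
    lift : ∀ {a c} b d → PrivateNeighbour (adj G) a c →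
           PrivateNeighbour (pairAdj G H) (a , b) (c , d)
    lift b d (x , x≢c , a∼x , c≁x) =
      (x , d) , x≢c ∘ cong proj₁ , cong (_∨ adj H b d) a∼x , cong₂ _∨_ c≁x (irrefl H d)

  separated-withinRow : ∀ {a b d} → NonUniversal G a → b ~[ H ] d →
                        Separated (pairAdj G H) (a , b) (a , d)
  separated-withinRow {a} {b} {d} (x , x≢a , a≁x) b∼d =
    trans (cong (_∨ adj H b d) (irrefl G a)) b∼d ,
    inj₁ ((x , d) , x≢a ∘ cong proj₁ , trans (cong (adj G a x ∨_) b∼d) (∨-zeroʳ _) ,
          cong₂ _∨_ a≁x (irrefl H d))

  separated-product : ∀ {X W} → IsTwinsFreeClique G X → (∀ {a} → a ∈ X → NonUniversal G a) →
                      IsClique H W → ∀ {p q} → InProduct X W p → InProduct X W q → p ≢ q →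
                      Separated (pairAdj G H) p q
  separated-product tfc nonUniversal clique {a , b} {c , d} (a∈X , b∈W) (c∈X , d∈W) p≢q with a ≟ c
  ... | no a≢c   = separated-acrossRows tfc a∈X c∈X a≢c b d
  ... | yes refl = separated-withinRow (nonUniversal a∈X) (clique b d b∈W d∈W (p≢q ∘ cong (a ,_)))

  separated-rowPinned : ∀ {X W x₀ b₀} → IsTwinsFreeClique G X →
    (∀ {a} → a ∈ X → a ≢ x₀ → x₀ ∈ X × NonUniversal G a) → IsClique H W → ∀ {p q} →
    InProduct (X - x₀) W p ⊎ p ≡ (x₀ , b₀) → InProduct (X - x₀) W q ⊎ q ≡ (x₀ , b₀) → p ≢ q →
    Separated (pairAdj G H) p q
  separated-rowPinned {X} {x₀ = x₀} tfc candidate clique (inj₁ p∈) (inj₁ q∈) p≢q =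
    separated-product (twinsFreeClique-⊆ G (p─q⊆p X ⁅ x₀ ⁆) tfc)
                      (λ a∈ → proj₂ (uncurry candidate (x∈p-y⁻ a∈))) clique p∈ q∈ p≢q
  separated-rowPinned tfc candidate clique (inj₁ (a∈ , _)) (inj₂ refl) _ =
    let a∈X , a≢x₀ = x∈p-y⁻ a∈ in
    separated-acrossRows tfc a∈X (proj₁ (candidate a∈X a≢x₀)) a≢x₀ _ _
  separated-rowPinned tfc candidate clique (inj₂ refl) (inj₁ (c∈ , _)) _ =
    let c∈X , c≢x₀ = x∈p-y⁻ c∈ in
    separated-acrossRows tfc (proj₁ (candidate c∈X c≢x₀)) c∈X (c≢x₀ ∘ sym) _ _
  separated-rowPinned tfc candidate clique (inj₂ refl) (inj₂ refl) p≢p = ⊥-elim (p≢p refl)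

module _ {n n'} (G : Graph n) (H : Graph n') where

  separated-swap : ∀ {p q} → Separated (pairAdj H G) (swap p) (swap q) → Separated (pairAdj G H) p q
  separated-swap =
    separated-pullback swap swap (λ _ → refl) λ (a , b) (c , d) → ∨-comm (adj G a c) (adj H b d)

  ⊕-twinsFreeClique : ∀ {S} →
    (∀ {u v} → u ∈ S → v ∈ S → remQuot {n} n' u ≢ remQuot n' v →
      Separated (pairAdj G H) (remQuot n' u) (remQuot n' v)) →
    IsTwinsFreeClique (G ⊕ H) S
  ⊕-twinsFreeClique separated = separated⇒twinsFreeClique (G ⊕ H) λ u∈S v∈S u≢v →
    separated-pullback {_∼_ = pairAdj G H} (remQuot {n} n') (uncurry combine)
      (λ (i , j) → remQuot-combine i j) (λ _ _ → refl)
      (separated u∈S v∈S (u≢v ∘ remQuot-injective {n} n'))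

  ⊗-twinsFreeCliqueˡ : ∀ {X W} → IsTwinsFreeClique G X → (∀ {a} → a ∈ X → NonUniversal G a) →
                       IsClique H W → IsTwinsFreeClique (G ⊕ H) (X ⊗ W)
  ⊗-twinsFreeCliqueˡ tfc nonUniversal clique = ⊕-twinsFreeClique λ u∈ v∈ →
    separated-product G H tfc nonUniversal clique (∈-⊗⁻ _ _ u∈) (∈-⊗⁻ _ _ v∈)

  ⊗-twinsFreeCliqueʳ : ∀ {W Y} → IsClique G W → IsTwinsFreeClique H Y →
                       (∀ {b} → b ∈ Y → NonUniversal H b) → IsTwinsFreeClique (G ⊕ H) (W ⊗ Y)
  ⊗-twinsFreeCliqueʳ clique tfc nonUniversal = ⊕-twinsFreeClique λ u∈ v∈ u≢v → separated-swap
    (separated-product H G tfc nonUniversal clique (swap (∈-⊗⁻ _ _ u∈)) (swap (∈-⊗⁻ _ _ v∈))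
                       (u≢v ∘ cong swap))

  rowPinned-twinsFreeClique : ∀ {X W x₀ b₀} → IsTwinsFreeClique G X →
    (∀ {a} → a ∈ X → a ≢ x₀ → x₀ ∈ X × NonUniversal G a) → IsClique H W →
    IsTwinsFreeClique (G ⊕ H) (rowPinned X x₀ W b₀)
  rowPinned-twinsFreeClique tfc candidate clique = ⊕-twinsFreeClique λ u∈ v∈ →
    separated-rowPinned G H tfc candidate clique (∈-rowPinned⁻ u∈) (∈-rowPinned⁻ v∈)

  columnPinned-twinsFreeClique : ∀ {W Y a₀ y₀} → IsClique G W → IsTwinsFreeClique H Y →
    (∀ {b} → b ∈ Y → b ≢ y₀ → y₀ ∈ Y × NonUniversal H b) →
    IsTwinsFreeClique (G ⊕ H) (columnPinned W a₀ Y y₀)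
  columnPinned-twinsFreeClique clique tfc candidate = ⊕-twinsFreeClique λ u∈ v∈ u≢v → separated-swap
    (separated-rowPinned H G tfc candidate clique (∈-columnPinned⁻ u∈) (∈-columnPinned⁻ v∈)
                         (u≢v ∘ cong swap))

+-⊔-lub : ∀ d {x y N} → d + x ≤ N → d + y ≤ N → d + (x ⊔ y) ≤ N
+-⊔-lub d {x} {y} {N} dx≤N dy≤N = subst (_≤ N) (sym (+-distribˡ-⊔ d x y)) (⊔-lub dx≤N dy≤N)

+-⊔-lub-+1 : ∀ d {x y N} → d + (x + 1) ≤ N → d + (y + 1) ≤ N → d + (x ⊔ y) + 1 ≤ N
+-⊔-lub-+1 d {x} {y} {N} dx≤N dy≤N = subst (_≤ N)
  (trans (cong (d +_) (sym (+-distribʳ-⊔ 1 x y))) (sym (+-assoc d (x ⊔ y) 1))) (+-⊔-lub d dx≤N dy≤N)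

module StrongMetricDimBounds {n n'} (G : Graph n) (H : Graph n') {d} (2≤n : 2 ≤ n) (2≤n' : 2 ≤ n')
  (connected : Connected (G ⊕ H)) (dim : IsStrongMetricDim (G ⊕ H) d) where

  private
    g₀ : Fin n
    g₀ = proj₁ (two-vertices 2≤n)

    h₀ : Fin n'
    h₀ = proj₁ (two-vertices 2≤n')

    twinsFreeClique-bound : ∀ {P} → IsTwinsFreeClique (G ⊕ H) P → d + ∣ P ∣ ≤ n * n'
    twinsFreeClique-bound =
      strongMetricDim+twinsFreeClique≤order (G ⊕ H) (*-mono-≤ 2≤n (≤-trans (s≤s z≤n) 2≤n'))
                                            connected dim

  product-boundˡ : ∀ {ϖ W} →
    (Σ (Subset n) λ X → IsTwinsFreeClique G X × ∣ X ∣ ≡ ϖ × (∀ v → v ∈ X → deg G v ≢ n ∸ 1)) →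
    IsClique H W → d + ϖ * ∣ W ∣ ≤ n * n'
  product-boundˡ {W = W} (X , tfc , refl , deg≢) clique =
    subst (λ k → d + k ≤ n * n') (∣p⊗q∣≡∣p∣*∣q∣ X W)
    (twinsFreeClique-bound (⊗-twinsFreeCliqueˡ G H tfc (deg≢N∸1⇒nonUniversal G ∘ deg≢ _) clique))

  product-boundʳ : ∀ {W ϖ} → IsClique G W →
    (Σ (Subset n') λ Y → IsTwinsFreeClique H Y × ∣ Y ∣ ≡ ϖ × (∀ v → v ∈ Y → deg H v ≢ n' ∸ 1)) →
    d + ∣ W ∣ * ϖ ≤ n * n'
  product-boundʳ {W} clique (Y , tfc , refl , deg≢) =
    subst (λ k → d + k ≤ n * n') (∣p⊗q∣≡∣p∣*∣q∣ W Y)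
    (twinsFreeClique-bound (⊗-twinsFreeCliqueʳ G H clique tfc (deg≢N∸1⇒nonUniversal H ∘ deg≢ _)))

  pinned-boundˡ : ∀ {X W} → IsTwinsFreeClique G X → IsClique H W →
                  d + ((∣ X ∣ ∸ 1) * ∣ W ∣ + 1) ≤ n * n'
  pinned-boundˡ {X} {W} tfc clique with universal-candidate G tfc g₀
  ... | x₀ , candidate =
    ≤-trans (+-monoʳ-≤ d (∣rowPinned∣ X x₀ W h₀))
            (twinsFreeClique-bound (rowPinned-twinsFreeClique G H tfc candidate clique))

  pinned-boundʳ : ∀ {W Y} → IsClique G W → IsTwinsFreeClique H Y →
                  d + (∣ W ∣ * (∣ Y ∣ ∸ 1) + 1) ≤ n * n'
  pinned-boundʳ {W} {Y} clique tfc with universal-candidate H tfc h₀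
  ... | y₀ , candidate =
    ≤-trans (+-monoʳ-≤ d (∣columnPinned∣ W g₀ Y y₀))
            (twinsFreeClique-bound (columnPinned-twinsFreeClique G H clique tfc candidate))

proposition6 : (n n' : ℕ) (G : Graph n) (H : Graph n') →
    2 ≤ n → 2 ≤ n' → Connected (G ⊕ H) →
    (ωG ωH ϖG ϖH d : ℕ) →
    IsCliqueNumber G ωG → IsCliqueNumber H ωH →
    IsTwinsFreeCliqueNumber G ϖG → IsTwinsFreeCliqueNumber H ϖH →
    IsStrongMetricDim (G ⊕ H) d →
    (d + (((ϖG ∸ 1) * ωH) ⊔ (ωG * (ϖH ∸ 1))) + 1 ≤ n * n')
    × ((Σ (Subset n) λ X → IsTwinsFreeClique G X × ∣ X ∣ ≡ ϖG ×
           (∀ v → v ∈ X → deg G v ≢ n ∸ 1)) →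
       (Σ (Subset n') λ Y → IsTwinsFreeClique H Y × ∣ Y ∣ ≡ ϖH ×
           (∀ v → v ∈ Y → deg H v ≢ n' ∸ 1)) →
       d + ((ϖG * ωH) ⊔ (ωG * ϖH)) ≤ n * n')
    × ((Σ (Subset n) λ X → IsTwinsFreeClique G X × ∣ X ∣ ≡ ϖG ×
           (∀ v → v ∈ X → deg G v ≢ n ∸ 1)) →
       d + ((ϖG * ωH) ⊔ (ωG * (ϖH ∸ 1) + 1)) ≤ n * n')
proposition6 n n' G H 2≤n 2≤n' connected ωG ωH ϖG ϖH d
  ((WG , cliqueWG , refl) , _) ((WH , cliqueWH , refl) , _)
  ((XG , tfcXG , refl) , _) ((XH , tfcXH , refl) , _) dim =
  +-⊔-lub-+1 d (pinned-boundˡ tfcXG cliqueWH) (pinned-boundʳ cliqueWG tfcXH) ,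
  (λ X Y → +-⊔-lub d (product-boundˡ X cliqueWH) (product-boundʳ cliqueWG Y)) ,
  (λ X → +-⊔-lub d (product-boundˡ X cliqueWH) (pinned-boundʳ cliqueWG tfcXH))
  where open StrongMetricDimBounds G H 2≤n 2≤n' connected dim
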